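{- (Cut elimination for $\mathrm{SLT}_{\omega}$.) The rule (cut) is admissible in cut-free $\mathrm{SLT}_{\omega}$: for every sequent $\Gamma \Rightarrow \gamma$, if $\Gamma \Rightarrow \gamma$ is derivable in $\mathrm{SLT}_{\omega}$, then $\Gamma \Rightarrow \gamma$ is derivable in $\mathrm{SLT}_{\omega}$ without any application of (cut).
   Context: Formulas are built from countably many propositional variables $p,q,\dots$ using the binary connectives $\to,\wedge,\vee$ and the unary connectives $\neg$, $\mathrm{G}$, $\mathrm{F}$, $\mathrm{X}$. For $i\in\omega$, $\mathrm{X}^0\alpha := \alpha$ and $\mathrm{X}^{n+1}\alpha := \mathrm{X}^n\mathrm{X}\alpha$. Greek capitals $\Gamma,\Sigma$ denote finite (possibly empty) sets of formulas, and a comma denotes set union. A sequent of $\mathrm{SLT}_{\omega}$ is an expression $\Gamma \Rightarrow \gamma$ where $\gamma$ is a single formula or empty. Derivations are well-founded, possibly infinitely branching trees built from the following, where $i,k$ are arbitrary natural numbers, $p$ a propositional variable, $\gamma$ a formula or empty: Initial sequents: $\mathrm{X}^i p, \Gamma \Rightarrow \mathrm{X}^i p$. (cut): from $\Gamma\Rightarrow\alpha$ and $\alpha,\Sigma\Rightarrow\gamma$ infer $\Gamma,\Sigma\Rightarrow\gamma$. (we-right): from $\Gamma\Rightarrow$ infer $\Gamma\Rightarrow\alpha$. ($\to$left): from $\Gamma\Rightarrow \mathrm{X}^i\alpha$ and $\mathrm{X}^i\beta,\Gamma\Rightarrow\gamma$ infer $\mathrm{X}^i(\alpha\to\beta),\Gamma\Rightarrow\gamma$.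 ($\to$right): from $\mathrm{X}^i\alpha,\Gamma\Rightarrow\mathrm{X}^i\beta$ infer $\Gamma\Rightarrow\mathrm{X}^i(\alpha\to\beta)$. ($\neg$left): from $\Gamma\Rightarrow\mathrm{X}^i\alpha$ infer $\mathrm{X}^i\neg\alpha,\Gamma\Rightarrow$ (empty succedent). ($\neg$right): from $\mathrm{X}^i\alpha,\Gamma\Rightarrow$ infer $\Gamma\Rightarrow\mathrm{X}^i\neg\alpha$. (ex-middle): from $\mathrm{X}^i\neg\alpha,\Gamma\Rightarrow\gamma$ and $\mathrm{X}^i\alpha,\Gamma\Rightarrow\gamma$ infer $\Gamma\Rightarrow\gamma$. ($\wedge$left): from $\mathrm{X}^i\alpha,\mathrm{X}^i\beta,\Gamma\Rightarrow\gamma$ infer $\mathrm{X}^i(\alpha\wedge\beta),\Gamma\Rightarrow\gamma$. ($\wedge$right): from $\Gamma\Rightarrow\mathrm{X}^i\alpha$ and $\Gamma\Rightarrow\mathrm{X}^i\beta$ infer $\Gamma\Rightarrow\mathrm{X}^i(\alpha\wedge\beta)$. ($\vee$left): from $\mathrm{X}^i\alpha,\Gamma\Rightarrow\gamma$ and $\mathrm{X}^i\beta,\Gamma\Rightarrow\gamma$ infer $\mathrm{X}^i(\alpha\vee\beta),\Gamma\Rightarrow\gamma$. ($\vee$right1)/($\vee$right2): from $\Gamma\Rightarrow\mathrm{X}^i\alpha$ (resp. $\Gamma\Rightarrow\mathrm{X}^i\beta$) infer $\Gamma\Rightarrow\mathrm{X}^i(\alpha\vee\beta)$. (Gleft): from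 $\mathrm{X}^{i+k}\alpha,\Gamma\Rightarrow\gamma$ infer $\mathrm{X}^i\mathrm{G}\alpha,\Gamma\Rightarrow\gamma$. (Gright): from all $\Gamma\Rightarrow\mathrm{X}^{i+j}\alpha$ for $j\in\omega$ infer $\Gamma\Rightarrow\mathrm{X}^i\mathrm{G}\alpha$. (Fleft): from all $\mathrm{X}^{i+j}\alpha,\Gamma\Rightarrow\gamma$ for $j\in\omega$ infer $\mathrm{X}^i\mathrm{F}\alpha,\Gamma\Rightarrow\gamma$. (Fright): from $\Gamma\Rightarrow\mathrm{X}^{i+k}\alpha$ infer $\Gamma\Rightarrow\mathrm{X}^i\mathrm{F}\alpha$. Cut-free $\mathrm{SLT}_{\omega}$ is the system without (cut). -}

module Defs where

open import Data.Nat using (ℕ; zero; suc; _+_)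
open import Data.List using (List; _∷_; _++_)
open import Data.Maybe using (Maybe; just; nothing)
open import Data.List.Membership.Propositional using (_∈_)
open import Function.Bundles using (_⇔_)
open import Relation.Binary.PropositionalEquality using (_≡_)

data Fm : Set where
  var  : ℕ → Fm
  _⇒_  : Fm → Fm → Fm
  _∧_  : Fm → Fm → Fm
  _∨_  : Fm → Fm → Fm
  ¬_   : Fm → Fm
  G    : Fm → Fm
  F    : Fm → Fm
  X    : Fm → Fm

Xⁿ : ℕ → Fm → Fm
Xⁿ zero    a = a
Xⁿ (suc n) a = Xⁿ n (X a)

-- Finite sets of formulas are represented by lists, identified up to
-- having the same elements; "a comma denotes set union" becomes _∷_ / _++_.
Ctx : Set
Ctx = List Fm

_≈ˢ_ : Ctx → Ctx → Set
Γ ≈ˢ Δ = ∀ a → (a ∈ Γ) ⇔ (a ∈ Δ)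

Succ : Set
Succ = Maybe Fm

data Mode : Set where
  withCut cutFree : Mode

-- Derivability in SLT_ω (mode withCut) and in cut-free SLT_ω (mode cutFree).
-- Derivations are well-founded (inductive), possibly infinitely branching trees.
data Der (m : Mode) : Ctx → Succ → Set where
  -- sequents are between sets: derivability is invariant under set equality
  set≈   : ∀ {Γ Δ γ} → Γ ≈ˢ Δ → Der m Γ γ → Der m Δ γ
  init   : ∀ {i p Γ} → Der m (Xⁿ i (var p) ∷ Γ) (just (Xⁿ i (var p)))
  cut    : ∀ {Γ Σ α γ} → m ≡ withCut →
           Der m Γ (just α) → Der m (α ∷ Σ) γ → Der m (Γ ++ Σ) γ
  we-r   : ∀ {Γ α} → Der m Γ nothing → Der m Γ (just α)
  ⇒l     : ∀ {i α β Γ γ} → Der m Γ (just (Xⁿ i α)) → Der m (Xⁿ i β ∷ Γ) γ →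
           Der m (Xⁿ i (α ⇒ β) ∷ Γ) γ
  ⇒r     : ∀ {i α β Γ} → Der m (Xⁿ i α ∷ Γ) (just (Xⁿ i β)) →
           Der m Γ (just (Xⁿ i (α ⇒ β)))
  ¬l     : ∀ {i α Γ} → Der m Γ (just (Xⁿ i α)) → Der m (Xⁿ i (¬ α) ∷ Γ) nothing
  ¬r     : ∀ {i α Γ} → Der m (Xⁿ i α ∷ Γ) nothing → Der m Γ (just (Xⁿ i (¬ α)))
  exmid  : ∀ {i α Γ γ} → Der m (Xⁿ i (¬ α) ∷ Γ) γ → Der m (Xⁿ i α ∷ Γ) γ →
           Der m Γ γ
  ∧l     : ∀ {i α β Γ γ} → Der m (Xⁿ i α ∷ Xⁿ i β ∷ Γ) γ →
           Der m (Xⁿ i (α ∧ β) ∷ Γ) γ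
  ∧r     : ∀ {i α β Γ} → Der m Γ (just (Xⁿ i α)) → Der m Γ (just (Xⁿ i β)) →
           Der m Γ (just (Xⁿ i (α ∧ β)))
  ∨l     : ∀ {i α β Γ γ} → Der m (Xⁿ i α ∷ Γ) γ → Der m (Xⁿ i β ∷ Γ) γ →
           Der m (Xⁿ i (α ∨ β) ∷ Γ) γ
  ∨r1    : ∀ {i α β Γ} → Der m Γ (just (Xⁿ i α)) → Der m Γ (just (Xⁿ i (α ∨ β)))
  ∨r2    : ∀ {i α β Γ} → Der m Γ (just (Xⁿ i β)) → Der m Γ (just (Xⁿ i (α ∨ β)))
  Gl     : ∀ {i k α Γ γ} → Der m (Xⁿ (i + k) α ∷ Γ) γ → Der m (Xⁿ i (G α) ∷ Γ) γ
  Gr     : ∀ {i α Γ} → ((j : ℕ) → Der m Γ (just (Xⁿ (i + j) α))) →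
           Der m Γ (just (Xⁿ i (G α)))
  Fl     : ∀ {i α Γ γ} → ((j : ℕ) → Der m (Xⁿ (i + j) α ∷ Γ) γ) →
           Der m (Xⁿ i (F α) ∷ Γ) γ
  Fr     : ∀ {i k α Γ} → Der m Γ (just (Xⁿ (i + k) α)) → Der m Γ (just (Xⁿ i (F α)))

{-# OPTIONS --safe #-}
-- Cut is derivable from (ex-middle) on the cut formula: from Γ ⇒ α, (¬left)
-- gives ¬α, Γ ⇒, and once both this and α, Σ ⇒ γ are weakened to the context
-- Γ, Σ they are the two premises of (ex-middle) with conclusion Γ, Σ ⇒ γ.
-- So the only real work is the admissibility of weakening, which holds for
-- derivations with or without cut.

module Submission where

open import Defs
open import Data.List using (_∷_; _++_)
open import Data.List.Membership.Propositional using (_∈_)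
open import Data.List.Membership.Propositional.Properties using (∈-++⁺ʳ; ∈-++⁻)
open import Data.List.Relation.Binary.Subset.Propositional using (_⊆_)
open import Data.List.Relation.Binary.Subset.Propositional.Properties
  using (∷⁺ʳ; xs⊆xs++ys; xs⊆ys++xs)
open import Data.List.Relation.Unary.Any using (here; there)
open import Data.Maybe using (just; nothing)
open import Data.Sum using ([_,_]′)
open import Function using (id; _∘_)
open import Function.Bundles using (mk⇔; Equivalence)
open import Relation.Binary.PropositionalEquality using (refl)

private
  variable
    m : Mode
    Γ Δ Σ : Ctx
    a : Fm
    γ : Succ

∷⊆⇒∈ : a ∷ Γ ⊆ Δ → a ∈ Δ
∷⊆⇒∈ s = s (here refl)

∷⊆⇒⊆ : a ∷ Γ ⊆ Δ → Γ ⊆ Δ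
∷⊆⇒⊆ s = s ∘ there

contract : Γ ⊆ Δ → Der m (Γ ++ Δ) γ → Der m Δ γ
contract {Γ} Γ⊆Δ = set≈ λ a → mk⇔ ([ Γ⊆Δ , id ]′ ∘ ∈-++⁻ Γ) (∈-++⁺ʳ Γ)

contract-∈ : a ∈ Δ → Der m (a ∷ Δ) γ → Der m Δ γ
contract-∈ a∈Δ = contract λ { (here refl) → a∈Δ }

-- Left rules are re-applied with their principal formula in front of Δ, and
-- the duplicate occurrence is then contracted away.
weaken : Γ ⊆ Δ → Der m Γ γ → Der m Δ γ
weaken s (set≈ e d) = weaken (s ∘ Equivalence.to (e _)) d
weaken s (init {i} {p}) = contract-∈ (∷⊆⇒∈ s) (init {i = i} {p})
weaken s (cut {Γ} eq d₁ d₂) =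
  contract id (cut eq (weaken (s ∘ xs⊆xs++ys Γ _) d₁)
                      (weaken (∷⁺ʳ _ (s ∘ xs⊆ys++xs _ Γ)) d₂))
weaken s (we-r d) = we-r (weaken s d)
weaken s (⇒l {i} {α} {β} d₁ d₂) =
  contract-∈ (∷⊆⇒∈ s)
    (⇒l {i = i} {α} {β} (weaken (∷⊆⇒⊆ s) d₁) (weaken (∷⁺ʳ _ (∷⊆⇒⊆ s)) d₂))
weaken s (⇒r {i} {α} {β} d) = ⇒r {i = i} {α} {β} (weaken (∷⁺ʳ _ s) d)
weaken s (¬l {i} {α} d) = contract-∈ (∷⊆⇒∈ s) (¬l {i = i} {α} (weaken (∷⊆⇒⊆ s) d))
weaken s (¬r {i} {α} d) = ¬r {i = i} {α} (weaken (∷⁺ʳ _ s) d)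
weaken s (exmid {i} {α} d₁ d₂) =
  exmid {i = i} {α} (weaken (∷⁺ʳ _ s) d₁) (weaken (∷⁺ʳ _ s) d₂)
weaken s (∧l {i} {α} {β} d) =
  contract-∈ (∷⊆⇒∈ s) (∧l {i = i} {α} {β} (weaken (∷⁺ʳ _ (∷⁺ʳ _ (∷⊆⇒⊆ s))) d))
weaken s (∧r {i} {α} {β} d₁ d₂) = ∧r {i = i} {α} {β} (weaken s d₁) (weaken s d₂)
weaken s (∨l {i} {α} {β} d₁ d₂) =
  contract-∈ (∷⊆⇒∈ s)
    (∨l {i = i} {α} {β} (weaken (∷⁺ʳ _ (∷⊆⇒⊆ s)) d₁) (weaken (∷⁺ʳ _ (∷⊆⇒⊆ s)) d₂))
weaken s (∨r1 {i} {α} {β} d) = ∨r1 {i = i} {α} {β} (weaken s d)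
weaken s (∨r2 {i} {α} {β} d) = ∨r2 {i = i} {α} {β} (weaken s d)
weaken s (Gl {i} {k} {α} d) =
  contract-∈ (∷⊆⇒∈ s) (Gl {i = i} {k} {α} (weaken (∷⁺ʳ _ (∷⊆⇒⊆ s)) d))
weaken s (Gr {i} {α} f) = Gr {i = i} {α} (weaken s ∘ f)
weaken s (Fl {i} {α} f) =
  contract-∈ (∷⊆⇒∈ s) (Fl {i = i} {α} (weaken (∷⁺ʳ _ (∷⊆⇒⊆ s)) ∘ f))
weaken s (Fr {i} {k} {α} d) = Fr {i = i} {k} {α} (weaken s d)

we-r′ : Der m Γ nothing → Der m Γ γ
we-r′ {γ = nothing} d = d
we-r′ {γ = just _}  d = we-r d

cut-by-exmid : Der m Γ (just a) → Der m (a ∷ Σ) γ → Der m (Γ ++ Σ) γ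
cut-by-exmid {Γ = Γ} {a = a} d₁ d₂ =
  exmid {i = 0} {a}
    (we-r′ (weaken (∷⁺ʳ _ (xs⊆xs++ys Γ _)) (¬l {i = 0} d₁)))
    (weaken (∷⁺ʳ _ (xs⊆ys++xs _ Γ)) d₂)

eliminate-cut : Der withCut Γ γ → Der cutFree Γ γ
eliminate-cut (set≈ e d) = set≈ e (eliminate-cut d)
eliminate-cut (init {i} {p}) = init {i = i} {p}
eliminate-cut (cut _ d₁ d₂) = cut-by-exmid (eliminate-cut d₁) (eliminate-cut d₂)
eliminate-cut (we-r d) = we-r (eliminate-cut d)
eliminate-cut (⇒l {i} {α} {β} d₁ d₂) = ⇒l {i = i} {α} {β} (eliminate-cut d₁) (eliminate-cut d₂)
eliminate-cut (⇒r {i} {α} {β} d) = ⇒r {i = i} {α} {β} (eliminate-cut d)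
eliminate-cut (¬l {i} {α} d) = ¬l {i = i} {α} (eliminate-cut d)
eliminate-cut (¬r {i} {α} d) = ¬r {i = i} {α} (eliminate-cut d)
eliminate-cut (exmid {i} {α} d₁ d₂) = exmid {i = i} {α} (eliminate-cut d₁) (eliminate-cut d₂)
eliminate-cut (∧l {i} {α} {β} d) = ∧l {i = i} {α} {β} (eliminate-cut d)
eliminate-cut (∧r {i} {α} {β} d₁ d₂) = ∧r {i = i} {α} {β} (eliminate-cut d₁) (eliminate-cut d₂)
eliminate-cut (∨l {i} {α} {β} d₁ d₂) = ∨l {i = i} {α} {β} (eliminate-cut d₁) (eliminate-cut d₂)
eliminate-cut (∨r1 {i} {α} {β} d) = ∨r1 {i = i} {α} {β} (eliminate-cut d)
eliminate-cut (∨r2 {i} {α} {β} d) = ∨r2 {i = i} {α} {β} (eliminate-cut d)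
eliminate-cut (Gl {i} {k} {α} d) = Gl {i = i} {k} {α} (eliminate-cut d)
eliminate-cut (Gr {i} {α} f) = Gr {i = i} {α} (eliminate-cut ∘ f)
eliminate-cut (Fl {i} {α} f) = Fl {i = i} {α} (eliminate-cut ∘ f)
eliminate-cut (Fr {i} {k} {α} d) = Fr {i = i} {k} {α} (eliminate-cut d)

theorem1 : ∀ (Γ : Ctx) (γ : Succ) → Der withCut Γ γ → Der cutFree Γ γ
theorem1 Γ γ = eliminate-cut
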